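{- For every integer $N\ge1$, the group $L_N=\langle a,d\mid d^2,\ [d,d^{a^n}]\text{ for }0<n<N\rangle$ is virtually free.
   Context: $d^{a^n}$ denotes the conjugate of $d$ by $a^n$, and $[x,y]$ is the commutator. -}

module Defs where

open import Data.Nat using (ℕ; zero; suc; _<_)
open import Data.Fin using (Fin)
open import Data.List using (List; []; _∷_; _++_; reverse; map)
open import Data.Product using (Σ; ∃; _×_; _,_)
open import Data.Sum using (_⊎_)
open import Data.Empty using (⊥)
open import Relation.Binary.PropositionalEquality using (_≡_)

data Lit (X : Set) : Set where
  pos : X → Lit X
  neg : X → Lit X

Word : Set → Set
Word X = List (Lit X)

invLit : {X : Set} → Lit X → Lit X
invLit (pos x) = neg x
invLit (neg x) = pos x

inv : {X : Set} → Word X → Word X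
inv w = reverse (map invLit w)

-- The group ⟨ X | R ⟩ : words modulo the congruence generated by free
-- cancellation and the relators (R is a predicate selecting relators).

data _⊢_≈_ {X : Set} (R : Word X → Set) : Word X → Word X → Set where
  ≈refl   : ∀ {u} → R ⊢ u ≈ u
  ≈sym    : ∀ {u v} → R ⊢ u ≈ v → R ⊢ v ≈ u
  ≈trans  : ∀ {u v w} → R ⊢ u ≈ v → R ⊢ v ≈ w → R ⊢ u ≈ w
  cancel  : ∀ u l v → R ⊢ (u ++ (l ∷ invLit l ∷ v)) ≈ (u ++ v)
  relator : ∀ u r v → R r → R ⊢ (u ++ (r ++ v)) ≈ (u ++ v)

-- no relators: the free group on X
NoRel : (X : Set) → Word X → Set
NoRel X _ = ⊥

evalLit : {B X : Set} → (B → Word X) → Lit B → Word X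
evalLit ι (pos b) = ι b
evalLit ι (neg b) = inv (ι b)

eval : {B X : Set} → (B → Word X) → Word B → Word X
eval ι []      = []
eval ι (l ∷ w) = evalLit ι l ++ eval ι w

record IsSubgroup {X : Set} (R : Word X → Set) (H : Word X → Set) : Set where
  field
    respects : ∀ {u v} → R ⊢ u ≈ v → H u → H v
    has-ε    : H []
    has-∙    : ∀ {u v} → H u → H v → H (u ++ v)
    has-inv  : ∀ {u} → H u → H (inv u)

-- finitely many left cosets g₁H, …, g_kH cover the group
FiniteIndex : {X : Set} (R : Word X → Set) (H : Word X → Set) → Set
FiniteIndex {X} R H =
  Σ ℕ λ k → Σ (Fin k → Word X) λ g → ∀ w → Σ (Fin k) λ i → H (inv (g i) ++ w)

-- H is free with basis ι : B → H : the induced homomorphism F(B) → H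
-- is surjective onto H and injective (trivial kernel).
IsFreeSubgroup : {X : Set} (R : Word X → Set) (H : Word X → Set) → Set₁
IsFreeSubgroup {X} R H =
  Σ Set λ B → Σ (B → Word X) λ ι →
    (∀ b → H (ι b)) ×
    (∀ w → H w → Σ (Word B) λ u → R ⊢ eval ι u ≈ w) ×
    (∀ u → R ⊢ eval ι u ≈ [] → NoRel B ⊢ u ≈ [])

VirtuallyFree : {X : Set} (R : Word X → Set) → Set₁
VirtuallyFree {X} R =
  Σ (Word X → Set) λ H → IsSubgroup R H × FiniteIndex R H × IsFreeSubgroup R H

data Gen : Set where
  a d : Gen

pow : {X : Set} → Word X → ℕ → Word X
pow w zero    = []
pow w (suc n) = w ++ pow w n

conj : {X : Set} → Word X → Word X → Word X
conj x y = inv y ++ (x ++ y)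

comm : {X : Set} → Word X → Word X → Word X
comm x y = inv x ++ (inv y ++ (x ++ y))

wa wd : Word Gen
wa = pos a ∷ []
wd = pos d ∷ []

LRel : ℕ → Word Gen → Set
LRel N r = (r ≡ wd ++ wd)
         ⊎ Σ ℕ λ n → (0 < n) × (n < N) × (r ≡ comm wd (conj wd (pow wa n)))

module Submission where

-- L_N acts on the bit vectors of length N: a rotates a vector one place to the right and d
-- flips its first bit, so d^(a^n) flips bit n and every relator acts trivially.  Hence the
-- stabiliser H of the zero vector has index at most 2^N.  Recording, for each letter a of a
-- word, the bit that a carries from the last place to the first gives a cocycle into the free
-- group F on {0, 1} (a Reidemeister-Schreier rewriting).  It respects the relators and
-- inverts the substitution 0 ↦ a, 1 ↦ d^(a^(N-1)) a d of F into H, so that substitution is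
-- injective.  It is also onto H: the coset representatives s(b ∷ x) = a⁻¹ s(x) a d^b
-- satisfy s(x) w = (cocycle of w from x) · s(x · w).  So H is free of rank 2.

open import Defs
open import Data.Bool using (Bool; true; false; not; _xor_)
open import Data.Bool.Properties using (not-involutive; xor-identityʳ)
open import Data.Fin using (Fin)
open import Data.List using (List; []; _∷_; _++_; reverse; map; length; lookup)
open import Data.List.Properties using (++-assoc; ++-identityʳ; map-++; reverse-++; unfold-reverse)
open import Data.List.Membership.Propositional using (_∈_)
open import Data.List.Membership.Propositional.Properties using (∈-map⁺; ∈-++⁺ˡ; ∈-++⁺ʳ)
open import Data.List.Relation.Unary.Any using (here; index)
open import Data.List.Relation.Unary.Any.Properties using (lookup-index)
open import Data.Nat using (ℕ; zero; suc; _≤_; _<_; z≤n; s≤s; _+_)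
open import Data.Nat.Properties using (+-suc; +-identityʳ; m+n≤o⇒m≤o; m≤n⇒m≤1+n; ≤-refl; ≤-pred)
open import Data.Product using (Σ; _×_; _,_; proj₁; proj₂)
open import Data.Sum using (inj₁; inj₂)
open import Data.Vec using (Vec; []; _∷_; _∷ʳ_; head; tail; init; last; initLast; replicate)
open import Data.Vec.Properties using (init-∷ʳ; last-∷ʳ)
open import Relation.Binary.Bundles using (Setoid)
open import Relation.Binary.PropositionalEquality
  using (_≡_; refl; sym; trans; cong; cong₂; subst; module ≡-Reasoning)
import Relation.Binary.Reasoning.Setoid as SetoidReasoning

module _ {X : Set} where

  invLit-involutive : (l : Lit X) → invLit (invLit l) ≡ l
  invLit-involutive (pos x) = refl
  invLit-involutive (neg x) = refl

  inv-∷ : (l : Lit X) (w : Word X) → inv (l ∷ w) ≡ inv w ++ invLit l ∷ []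
  inv-∷ l w = unfold-reverse (invLit l) (map invLit w)

  inv-++ : (u v : Word X) → inv (u ++ v) ≡ inv v ++ inv u
  inv-++ u v = trans (cong reverse (map-++ invLit u v)) (reverse-++ (map invLit u) (map invLit v))

  inv-involutive : (w : Word X) → inv (inv w) ≡ w
  inv-involutive []      = refl
  inv-involutive (l ∷ w) = begin
    inv (inv (l ∷ w))                  ≡⟨ cong inv (inv-∷ l w) ⟩
    inv (inv w ++ invLit l ∷ [])       ≡⟨ inv-++ (inv w) (invLit l ∷ []) ⟩
    invLit (invLit l) ∷ inv (inv w)    ≡⟨ cong₂ _∷_ (invLit-involutive l) (inv-involutive w) ⟩
    l ∷ w                              ∎
    where open ≡-Reasoning

  pow-sucʳ : (w : Word X) (n : ℕ) → pow w (suc n) ≡ pow w n ++ w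
  pow-sucʳ w zero    = ++-identityʳ w
  pow-sucʳ w (suc n) = trans (cong (w ++_) (pow-sucʳ w n)) (sym (++-assoc w (pow w n) w))

  conj-conj : (u v w : Word X) → conj (conj u v) w ≡ conj u (v ++ w)
  conj-conj u v w = sym (begin
    inv (v ++ w) ++ u ++ v ++ w          ≡⟨ cong (_++ u ++ v ++ w) (inv-++ v w) ⟩
    (inv w ++ inv v) ++ u ++ v ++ w      ≡⟨ ++-assoc (inv w) (inv v) (u ++ v ++ w) ⟩
    inv w ++ inv v ++ u ++ v ++ w        ≡⟨ cong (λ z → inv w ++ inv v ++ z) (sym (++-assoc u v w)) ⟩
    inv w ++ inv v ++ (u ++ v) ++ w      ≡⟨ cong (inv w ++_) (sym (++-assoc (inv v) (u ++ v) w)) ⟩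
    inv w ++ (inv v ++ u ++ v) ++ w      ∎)
    where open ≡-Reasoning

module Presentation {X : Set} (R : Word X → Set) where

  infix 4 _≈_
  _≈_ : Word X → Word X → Set
  u ≈ v = R ⊢ u ≈ v

  setoid : Setoid _ _
  setoid = record
    { Carrier       = Word X
    ; _≈_           = _≈_
    ; isEquivalence = record { refl = ≈refl ; sym = ≈sym ; trans = ≈trans }
    }

  open Setoid setoid public using (reflexive)
  open SetoidReasoning setoid public

  ++-cong : ∀ p q {u v} → u ≈ v → p ++ u ++ q ≈ p ++ v ++ q
  ++-cong p q ≈refl        = ≈refl
  ++-cong p q (≈sym e)     = ≈sym (++-cong p q e)
  ++-cong p q (≈trans e f) = ≈trans (++-cong p q e) (++-cong p q f)
  ++-cong p q (cancel u l v) = begin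
    p ++ (u ++ l ∷ invLit l ∷ v) ++ q    ≡⟨ cong (p ++_) (++-assoc u _ q) ⟩
    p ++ u ++ l ∷ invLit l ∷ v ++ q      ≡⟨ ++-assoc p u _ ⟨
    (p ++ u) ++ l ∷ invLit l ∷ v ++ q    ≈⟨ cancel (p ++ u) l (v ++ q) ⟩
    (p ++ u) ++ v ++ q                   ≡⟨ ++-assoc p u (v ++ q) ⟩
    p ++ u ++ v ++ q                     ≡⟨ cong (p ++_) (++-assoc u v q) ⟨
    p ++ (u ++ v) ++ q                   ∎
  ++-cong p q (relator u r v r∈R) = begin
    p ++ (u ++ r ++ v) ++ q
      ≡⟨ cong (p ++_) (trans (++-assoc u _ q) (cong (u ++_) (++-assoc r v q))) ⟩
    p ++ u ++ r ++ v ++ q                ≡⟨ ++-assoc p u _ ⟨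
    (p ++ u) ++ r ++ v ++ q              ≈⟨ relator (p ++ u) r (v ++ q) r∈R ⟩
    (p ++ u) ++ v ++ q                   ≡⟨ ++-assoc p u (v ++ q) ⟩
    p ++ u ++ v ++ q                     ≡⟨ cong (p ++_) (++-assoc u v q) ⟨
    p ++ (u ++ v) ++ q                   ∎

  ++-congˡ : ∀ p {u v} → u ≈ v → p ++ u ≈ p ++ v
  ++-congˡ p {u} {v} e = begin
    p ++ u          ≡⟨ cong (p ++_) (++-identityʳ u) ⟨
    p ++ u ++ []    ≈⟨ ++-cong p [] e ⟩
    p ++ v ++ []    ≡⟨ cong (p ++_) (++-identityʳ v) ⟩
    p ++ v          ∎

  ++-congʳ : ∀ q {u v} → u ≈ v → u ++ q ≈ v ++ q
  ++-congʳ q = ++-cong [] q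

  ++-inverseʳ : ∀ w → w ++ inv w ≈ []
  ++-inverseʳ []      = ≈refl
  ++-inverseʳ (l ∷ w) = begin
    l ∷ w ++ inv (l ∷ w)                  ≡⟨ cong (λ z → l ∷ w ++ z) (inv-∷ l w) ⟩
    l ∷ w ++ inv w ++ invLit l ∷ []       ≡⟨ cong (l ∷_) (++-assoc w (inv w) _) ⟨
    l ∷ (w ++ inv w) ++ invLit l ∷ []     ≈⟨ ++-cong (l ∷ []) (invLit l ∷ []) (++-inverseʳ w) ⟩
    l ∷ invLit l ∷ []                     ≈⟨ cancel [] l [] ⟩
    []                                    ∎

  ++-inverseˡ : ∀ w → inv w ++ w ≈ []
  ++-inverseˡ w = subst (λ v → inv w ++ v ≈ []) (inv-involutive w) (++-inverseʳ (inv w))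

  cancelʳ : ∀ w q → w ++ inv w ++ q ≈ q
  cancelʳ w q = ≈trans (reflexive (sym (++-assoc w (inv w) q))) (++-congʳ q (++-inverseʳ w))

  cancelˡ : ∀ w q → inv w ++ w ++ q ≈ q
  cancelˡ w q = ≈trans (reflexive (sym (++-assoc (inv w) w q))) (++-congʳ q (++-inverseˡ w))

  relator≈[] : ∀ {r} → R r → r ≈ []
  relator≈[] {r} r∈R = ≈trans (reflexive (sym (++-identityʳ r))) (relator [] r [] r∈R)

  inv-cong : ∀ {u v} → u ≈ v → inv u ≈ inv v
  inv-cong {u} {v} e = begin
    inv u                  ≡⟨ ++-identityʳ (inv u) ⟨
    inv u ++ []            ≈⟨ ++-congˡ (inv u) (++-inverseʳ v) ⟨
    inv u ++ v ++ inv v    ≈⟨ ++-congˡ (inv u) (++-congʳ (inv v) e) ⟨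
    inv u ++ u ++ inv v    ≈⟨ cancelˡ u (inv v) ⟩
    inv v                  ∎

  move-inverses : ∀ p u q r → p ++ u ≈ q ++ r → r ++ inv u ≈ inv q ++ p
  move-inverses p u q r e = begin
    r ++ inv u                  ≈⟨ cancelˡ q (r ++ inv u) ⟨
    inv q ++ q ++ r ++ inv u    ≡⟨ cong (inv q ++_) (++-assoc q r (inv u)) ⟨
    inv q ++ (q ++ r) ++ inv u  ≈⟨ ++-cong (inv q) (inv u) e ⟨
    inv q ++ (p ++ u) ++ inv u  ≡⟨ cong (inv q ++_) (++-assoc p u (inv u)) ⟩
    inv q ++ p ++ u ++ inv u    ≈⟨ ++-congˡ (inv q) (++-congˡ p (++-inverseʳ u)) ⟩
    inv q ++ p ++ []            ≡⟨ cong (inv q ++_) (++-identityʳ p) ⟩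
    inv q ++ p                  ∎

  Commute : Word X → Word X → Set
  Commute u v = u ++ v ≈ v ++ u

  comm≈[]⇒commute : ∀ u v → comm u v ≈ [] → Commute u v
  comm≈[]⇒commute u v e = ≈sym (begin
    v ++ u                   ≡⟨ ++-identityʳ (v ++ u) ⟨
    (v ++ u) ++ []           ≈⟨ ++-congˡ (v ++ u) e ⟨
    (v ++ u) ++ comm u v     ≡⟨ ++-assoc v u (comm u v) ⟩
    v ++ u ++ comm u v       ≈⟨ ++-congˡ v (cancelʳ u (inv v ++ u ++ v)) ⟩
    v ++ inv v ++ u ++ v     ≈⟨ cancelʳ v (u ++ v) ⟩
    u ++ v                   ∎)

  commute-[] : ∀ w → Commute w []
  commute-[] w = reflexive (++-identityʳ w)

  commute-++ : ∀ {w u v} → Commute w u → Commute w v → Commute w (u ++ v)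
  commute-++ {w} {u} {v} wu wv = begin
    w ++ u ++ v      ≡⟨ ++-assoc w u v ⟨
    (w ++ u) ++ v    ≈⟨ ++-congʳ v wu ⟩
    (u ++ w) ++ v    ≡⟨ ++-assoc u w v ⟩
    u ++ w ++ v      ≈⟨ ++-congˡ u wv ⟩
    u ++ v ++ w      ≡⟨ ++-assoc u v w ⟨
    (u ++ v) ++ w    ∎

  commute-resp : ∀ {w u v} → u ≈ v → Commute w u → Commute w v
  commute-resp {w} e wu = ≈trans (++-congˡ w (≈sym e)) (≈trans wu (++-congʳ w e))

  conj-cong : ∀ p {u v} → u ≈ v → conj u p ≈ conj v p
  conj-cong p = ++-cong (inv p) p

  conj-[] : ∀ p → conj [] p ≈ []
  conj-[] = ++-inverseˡ

  conj-++ : ∀ p u v → conj (u ++ v) p ≈ conj u p ++ conj v p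
  conj-++ p u v = begin
    inv p ++ (u ++ v) ++ p                     ≡⟨ cong (inv p ++_) (++-assoc u v p) ⟩
    inv p ++ u ++ v ++ p                       ≈⟨ ++-congˡ (inv p) (++-congˡ u (cancelʳ p (v ++ p))) ⟨
    inv p ++ u ++ p ++ inv p ++ v ++ p         ≡⟨ cong (inv p ++_) (++-assoc u p _) ⟨
    inv p ++ (u ++ p) ++ inv p ++ v ++ p       ≡⟨ ++-assoc (inv p) (u ++ p) _ ⟨
    conj u p ++ conj v p                       ∎

  ++-conj : ∀ p w → p ++ conj w p ≈ w ++ p
  ++-conj p w = cancelʳ p (w ++ p)

module _ {B X : Set} (ι : B → Word X) where

  eval-++ : ∀ u v → eval ι (u ++ v) ≡ eval ι u ++ eval ι v
  eval-++ []      v = refl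
  eval-++ (l ∷ u) v = trans (cong (evalLit ι l ++_) (eval-++ u v)) (sym (++-assoc (evalLit ι l) _ _))

  evalLit-invLit : ∀ l → evalLit ι (invLit l) ≡ inv (evalLit ι l)
  evalLit-invLit (pos b) = refl
  evalLit-invLit (neg b) = sym (inv-involutive (ι b))

  eval-inv : ∀ u → eval ι (inv u) ≡ inv (eval ι u)
  eval-inv []      = refl
  eval-inv (l ∷ u) = begin
    eval ι (inv (l ∷ u))                              ≡⟨ cong (eval ι) (inv-∷ l u) ⟩
    eval ι (inv u ++ invLit l ∷ [])                   ≡⟨ eval-++ (inv u) (invLit l ∷ []) ⟩
    eval ι (inv u) ++ evalLit ι (invLit l) ++ []
      ≡⟨ cong₂ (λ v w → v ++ w ++ []) (eval-inv u) (evalLit-invLit l) ⟩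
    inv (eval ι u) ++ inv (evalLit ι l) ++ []         ≡⟨ cong (inv (eval ι u) ++_) (++-identityʳ _) ⟩
    inv (eval ι u) ++ inv (evalLit ι l)               ≡⟨ inv-++ (evalLit ι l) (eval ι u) ⟨
    inv (eval ι (l ∷ u))                              ∎
    where open ≡-Reasoning

module CocycleAction {X Y S : Set}
  (step : S → Lit X → S) (cocycle : S → Lit X → Word Y)
  (step-invLit : ∀ x l → step (step x l) (invLit l) ≡ x)
  (cocycle-invLit : ∀ x l → cocycle (step x l) (invLit l) ≡ inv (cocycle x l))
  where

  module F = Presentation (NoRel Y)

  act : S → Word X → S
  act x []      = x
  act x (l ∷ w) = act (step x l) w

  cocycleʷ : S → Word X → Word Y
  cocycleʷ x []      = []
  cocycleʷ x (l ∷ w) = cocycle x l ++ cocycleʷ (step x l) w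

  act-++ : ∀ x u v → act x (u ++ v) ≡ act (act x u) v
  act-++ x []      v = refl
  act-++ x (l ∷ u) v = act-++ (step x l) u v

  cocycleʷ-++ : ∀ x u v → cocycleʷ x (u ++ v) ≡ cocycleʷ x u ++ cocycleʷ (act x u) v
  cocycleʷ-++ x []      v = refl
  cocycleʷ-++ x (l ∷ u) v =
    trans (cong (cocycle x l ++_) (cocycleʷ-++ (step x l) u v)) (sym (++-assoc (cocycle x l) _ _))

  act-inverseʳ : ∀ x u → act (act x u) (inv u) ≡ x
  act-inverseʳ x []      = refl
  act-inverseʳ x (l ∷ u) = begin
    act (act y u) (inv (l ∷ u))                   ≡⟨ cong (act (act y u)) (inv-∷ l u) ⟩
    act (act y u) (inv u ++ invLit l ∷ [])        ≡⟨ act-++ (act y u) (inv u) _ ⟩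
    step (act (act y u) (inv u)) (invLit l)       ≡⟨ cong (λ z → step z (invLit l)) (act-inverseʳ y u) ⟩
    step y (invLit l)                             ≡⟨ step-invLit x l ⟩
    x                                             ∎
    where open ≡-Reasoning
          y = step x l

  act-inverseˡ : ∀ x u → act (act x (inv u)) u ≡ x
  act-inverseˡ x u = subst (λ v → act (act x (inv u)) v ≡ x) (inv-involutive u) (act-inverseʳ x (inv u))

  cocycleʷ-inverseʳ : ∀ x u → cocycleʷ (act x u) (inv u) ≡ inv (cocycleʷ x u)
  cocycleʷ-inverseʳ x []      = refl
  cocycleʷ-inverseʳ x (l ∷ u) = begin
    cocycleʷ z (inv (l ∷ u))                                     ≡⟨ cong (cocycleʷ z) (inv-∷ l u) ⟩
    cocycleʷ z (inv u ++ invLit l ∷ [])                          ≡⟨ cocycleʷ-++ z (inv u) _ ⟩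
    cocycleʷ z (inv u) ++ cocycle (act z (inv u)) (invLit l) ++ []
      ≡⟨ cong₂ (λ v w → v ++ cocycle w (invLit l) ++ []) (cocycleʷ-inverseʳ y u) (act-inverseʳ y u) ⟩
    inv (cocycleʷ y u) ++ cocycle y (invLit l) ++ []
      ≡⟨ cong (inv (cocycleʷ y u) ++_) (++-identityʳ _) ⟩
    inv (cocycleʷ y u) ++ cocycle y (invLit l)
      ≡⟨ cong (inv (cocycleʷ y u) ++_) (cocycle-invLit x l) ⟩
    inv (cocycleʷ y u) ++ inv (cocycle x l)                      ≡⟨ inv-++ (cocycle x l) (cocycleʷ y u) ⟨
    inv (cocycleʷ x (l ∷ u))                                     ∎
    where open ≡-Reasoning
          y = step x l
          z = act y u

  cocycleʷ-inverseˡ : ∀ x u → cocycleʷ x (inv u) ≡ inv (cocycleʷ (act x (inv u)) u)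
  cocycleʷ-inverseˡ x u =
    subst (λ y → cocycleʷ y (inv u) ≡ inv (cocycleʷ (act x (inv u)) u))
          (act-inverseˡ x u) (cocycleʷ-inverseʳ (act x (inv u)) u)

  CocycleTrivial : Word X → Set
  CocycleTrivial w = ∀ x → cocycleʷ x w F.≈ []

  cocycleTrivial-++ : ∀ u v → CocycleTrivial u → CocycleTrivial v → CocycleTrivial (u ++ v)
  cocycleTrivial-++ u v tu tv x =
    ≈trans (F.reflexive (cocycleʷ-++ x u v)) (≈trans (F.++-congʳ _ (tu x)) (tv (act x u)))

  cocycleTrivial-inv : ∀ u → CocycleTrivial u → CocycleTrivial (inv u)
  cocycleTrivial-inv u tu x =
    ≈trans (F.reflexive (cocycleʷ-inverseˡ x u)) (F.inv-cong (tu (act x (inv u))))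

  FixesRelators : (Word X → Set) → Set
  FixesRelators R = ∀ {r} → R r → (∀ x → act x r ≡ x) × CocycleTrivial r

  Stabiliser : S → Word X → Set
  Stabiliser x₀ w = act x₀ w ≡ x₀

  stabiliser-finiteIndex : ∀ {R} x₀ (xs : List S) → (∀ x → x ∈ xs) →
                           (reach : S → Word X) → (∀ x → act x₀ (reach x) ≡ x) →
                           FiniteIndex R (Stabiliser x₀)
  stabiliser-finiteIndex x₀ xs enum reach act-reach =
    length xs , (λ i → inv (reach (lookup xs i))) , coset
    where
    coset : ∀ w → Σ (Fin (length xs)) λ i → Stabiliser x₀ (inv (inv (reach (lookup xs i))) ++ w)
    coset w = index (enum x) , (begin
      act x₀ (inv (inv (reach y)) ++ w)    ≡⟨ cong (λ v → act x₀ (v ++ w)) (inv-involutive (reach y)) ⟩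
      act x₀ (reach y ++ w)                ≡⟨ act-++ x₀ (reach y) w ⟩
      act (act x₀ (reach y)) w             ≡⟨ cong (λ z → act z w) (act-reach y) ⟩
      act y w                              ≡⟨ cong (λ z → act z w) (lookup-index (enum x)) ⟨
      act (act x₀ (inv w)) w               ≡⟨ act-inverseˡ x₀ w ⟩
      x₀                                   ∎)
      where open ≡-Reasoning
            x = act x₀ (inv w)
            y = lookup xs (index (enum x))

  module _ {R : Word X → Set} (fixes : FixesRelators R) where

    act-resp : ∀ {u v} → R ⊢ u ≈ v → ∀ x → act x u ≡ act x v
    act-resp ≈refl              x = refl
    act-resp (≈sym e)           x = sym (act-resp e x)
    act-resp (≈trans e f)       x = trans (act-resp e x) (act-resp f x)
    act-resp (cancel u l v)     x = begin
      act x (u ++ l ∷ invLit l ∷ v)            ≡⟨ act-++ x u _ ⟩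
      act (step (step (act x u) l) (invLit l)) v ≡⟨ cong (λ z → act z v) (step-invLit (act x u) l) ⟩
      act (act x u) v                          ≡⟨ act-++ x u v ⟨
      act x (u ++ v)                           ∎
      where open ≡-Reasoning
    act-resp (relator u r v r∈R) x = begin
      act x (u ++ r ++ v)          ≡⟨ act-++ x u (r ++ v) ⟩
      act (act x u) (r ++ v)       ≡⟨ act-++ (act x u) r v ⟩
      act (act (act x u) r) v      ≡⟨ cong (λ z → act z v) (proj₁ (fixes r∈R) (act x u)) ⟩
      act (act x u) v              ≡⟨ act-++ x u v ⟨
      act x (u ++ v)               ∎
      where open ≡-Reasoning

    cocycleʷ-resp : ∀ {u v} → R ⊢ u ≈ v → ∀ x → cocycleʷ x u F.≈ cocycleʷ x v
    cocycleʷ-resp ≈refl          x = ≈refl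
    cocycleʷ-resp (≈sym e)       x = ≈sym (cocycleʷ-resp e x)
    cocycleʷ-resp (≈trans e f)   x = ≈trans (cocycleʷ-resp e x) (cocycleʷ-resp f x)
    cocycleʷ-resp (cancel u l v) x = begin
      cocycleʷ x (u ++ l ∷ invLit l ∷ v)
        ≡⟨ cocycleʷ-++ x u _ ⟩
      cocycleʷ x u ++ cocycle y l ++ cocycle (step y l) (invLit l) ++ cocycleʷ (step (step y l) (invLit l)) v
        ≡⟨ cong₂ (λ p z → cocycleʷ x u ++ cocycle y l ++ p ++ cocycleʷ z v) (cocycle-invLit y l) (step-invLit y l) ⟩
      cocycleʷ x u ++ cocycle y l ++ inv (cocycle y l) ++ cocycleʷ y v
        ≈⟨ F.++-congˡ (cocycleʷ x u) (F.cancelʳ (cocycle y l) (cocycleʷ y v)) ⟩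
      cocycleʷ x u ++ cocycleʷ y v
        ≡⟨ cocycleʷ-++ x u v ⟨
      cocycleʷ x (u ++ v) ∎
      where open F
            y = act x u
    cocycleʷ-resp (relator u r v r∈R) x = begin
      cocycleʷ x (u ++ r ++ v)
        ≡⟨ trans (cocycleʷ-++ x u _) (cong (cocycleʷ x u ++_) (cocycleʷ-++ y r v)) ⟩
      cocycleʷ x u ++ cocycleʷ y r ++ cocycleʷ (act y r) v
        ≈⟨ F.++-cong (cocycleʷ x u) _ (proj₂ (fixes r∈R) y) ⟩
      cocycleʷ x u ++ cocycleʷ (act y r) v
        ≡⟨ cong (λ z → cocycleʷ x u ++ cocycleʷ z v) (proj₁ (fixes r∈R) y) ⟩
      cocycleʷ x u ++ cocycleʷ y v
        ≡⟨ cocycleʷ-++ x u v ⟨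
      cocycleʷ x (u ++ v) ∎
      where open F
            y = act x u

    stabiliser-isSubgroup : ∀ x₀ → IsSubgroup R (Stabiliser x₀)
    stabiliser-isSubgroup x₀ = record
      { respects = λ e fixes-u → trans (sym (act-resp e x₀)) fixes-u
      ; has-ε    = refl
      ; has-∙    = λ {u} {v} fixes-u fixes-v →
                     trans (act-++ x₀ u v) (trans (cong (λ z → act z v) fixes-u) fixes-v)
      ; has-inv  = λ {u} fixes-u →
                     trans (cong (λ z → act z (inv u)) (sym fixes-u)) (act-inverseʳ x₀ u)
      }

    private module L = Presentation R

    module _ (x₀ : S) (ι : Y → Word X)
             (ι-fixes : ∀ y → act x₀ (ι y) ≡ x₀)
             (ι-cocycle : ∀ y → cocycleʷ x₀ (ι y) F.≈ pos y ∷ []) where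

      evalLit-fixes : ∀ l → act x₀ (evalLit ι l) ≡ x₀
      evalLit-fixes (pos y) = ι-fixes y
      evalLit-fixes (neg y) =
        subst (λ z → act z (inv (ι y)) ≡ x₀) (ι-fixes y) (act-inverseʳ x₀ (ι y))

      eval-fixes : ∀ u → act x₀ (eval ι u) ≡ x₀
      eval-fixes []      = refl
      eval-fixes (l ∷ u) = trans (act-++ x₀ (evalLit ι l) (eval ι u))
        (trans (cong (λ z → act z (eval ι u)) (evalLit-fixes l)) (eval-fixes u))

      cocycleʷ-evalLit : ∀ l → cocycleʷ x₀ (evalLit ι l) F.≈ l ∷ []
      cocycleʷ-evalLit (pos y) = ι-cocycle y
      cocycleʷ-evalLit (neg y) = begin
        cocycleʷ x₀ (inv (ι y))                         ≡⟨ cocycleʷ-inverseˡ x₀ (ι y) ⟩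
        inv (cocycleʷ (act x₀ (inv (ι y))) (ι y))
          ≡⟨ cong (λ z → inv (cocycleʷ z (ι y))) (evalLit-fixes (neg y)) ⟩
        inv (cocycleʷ x₀ (ι y))                         ≈⟨ F.inv-cong (ι-cocycle y) ⟩
        neg y ∷ []                                      ∎
        where open F

      cocycleʷ-eval : ∀ u → cocycleʷ x₀ (eval ι u) F.≈ u
      cocycleʷ-eval []      = ≈refl
      cocycleʷ-eval (l ∷ u) = begin
        cocycleʷ x₀ (evalLit ι l ++ eval ι u)
          ≡⟨ cocycleʷ-++ x₀ (evalLit ι l) (eval ι u) ⟩
        cocycleʷ x₀ (evalLit ι l) ++ cocycleʷ (act x₀ (evalLit ι l)) (eval ι u)
          ≡⟨ cong (λ z → cocycleʷ x₀ (evalLit ι l) ++ cocycleʷ z (eval ι u)) (evalLit-fixes l) ⟩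
        cocycleʷ x₀ (evalLit ι l) ++ cocycleʷ x₀ (eval ι u)
          ≈⟨ ≈trans (F.++-congʳ _ (cocycleʷ-evalLit l)) (F.++-congˡ (l ∷ []) (cocycleʷ-eval u)) ⟩
        l ∷ u ∎
        where open F

      module _ (s : S → Word X) (s-x₀ : s x₀ L.≈ [])
               (s-step : ∀ x g → s x ++ pos g ∷ [] L.≈ eval ι (cocycle x (pos g)) ++ s (step x (pos g)))
               where

        s-step-lit : ∀ x l → s x ++ l ∷ [] L.≈ eval ι (cocycle x l) ++ s (step x l)
        s-step-lit x (pos g) = s-step x g
        s-step-lit x (neg g) = ≈trans (L.move-inverses (s y) (pos g ∷ []) E (s x) s-step-y) (L.reflexive inv-E)
          where
          y = step x (neg g)
          E = eval ι (cocycle y (pos g))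
          s-step-y : s y ++ pos g ∷ [] L.≈ E ++ s x
          s-step-y = subst (λ z → s y ++ pos g ∷ [] L.≈ E ++ s z) (step-invLit x (neg g)) (s-step y g)
          inv-E : inv E ++ s y ≡ eval ι (cocycle x (neg g)) ++ s y
          inv-E = cong (_++ s y) (begin
            inv E                                           ≡⟨ eval-inv ι (cocycle y (pos g)) ⟨
            eval ι (inv (cocycle y (pos g)))
              ≡⟨ cong (λ w → eval ι (inv w)) (cocycle-invLit x (neg g)) ⟩
            eval ι (inv (inv (cocycle x (neg g))))
              ≡⟨ cong (eval ι) (inv-involutive (cocycle x (neg g))) ⟩
            eval ι (cocycle x (neg g))                     ∎)
            where open ≡-Reasoning

        s-++ : ∀ x w → s x ++ w L.≈ eval ι (cocycleʷ x w) ++ s (act x w)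
        s-++ x []      = L.reflexive (++-identityʳ (s x))
        s-++ x (l ∷ w) = begin
          s x ++ l ∷ w                         ≡⟨ ++-assoc (s x) (l ∷ []) w ⟨
          (s x ++ l ∷ []) ++ w                 ≈⟨ L.++-congʳ w (s-step-lit x l) ⟩
          (E ++ s y) ++ w                      ≡⟨ ++-assoc E (s y) w ⟩
          E ++ s y ++ w                        ≈⟨ L.++-congˡ E (s-++ y w) ⟩
          E ++ eval ι (cocycleʷ y w) ++ s (act y w)
            ≡⟨ ++-assoc E _ _ ⟨
          (E ++ eval ι (cocycleʷ y w)) ++ s (act y w)
            ≡⟨ cong (_++ s (act y w)) (eval-++ ι (cocycle x l) (cocycleʷ y w)) ⟨
          eval ι (cocycleʷ x (l ∷ w)) ++ s (act x (l ∷ w)) ∎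
          where open L
                y = step x l
                E = eval ι (cocycle x l)

        stabiliser-free : IsFreeSubgroup R (Stabiliser x₀)
        stabiliser-free = Y , ι , ι-fixes , generates , injective
          where
          generates : ∀ w → Stabiliser x₀ w → Σ (Word Y) λ u → eval ι u L.≈ w
          generates w fixes-w = cocycleʷ x₀ w , (begin
            eval ι (cocycleʷ x₀ w)                  ≡⟨ ++-identityʳ _ ⟨
            eval ι (cocycleʷ x₀ w) ++ []            ≈⟨ L.++-congˡ _ s-x₀ ⟨
            eval ι (cocycleʷ x₀ w) ++ s x₀          ≡⟨ cong (λ z → eval ι (cocycleʷ x₀ w) ++ s z) fixes-w ⟨
            eval ι (cocycleʷ x₀ w) ++ s (act x₀ w)  ≈⟨ s-++ x₀ w ⟨
            s x₀ ++ w                               ≈⟨ L.++-congʳ w s-x₀ ⟩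
            w                                       ∎)
            where open L
          injective : ∀ u → eval ι u L.≈ [] → u F.≈ []
          injective u e = ≈trans (≈sym (cocycleʷ-eval u)) (cocycleʷ-resp e x₀)

module _ {A : Set} where

  rotate : ∀ {n} → Vec A (suc n) → Vec A (suc n)
  rotate xs = last xs ∷ init xs

  rotate⁻¹ : ∀ {n} → Vec A (suc n) → Vec A (suc n)
  rotate⁻¹ (x ∷ xs) = xs ∷ʳ x

  rotate-∷ʳ : ∀ {n} (xs : Vec A n) x → rotate (xs ∷ʳ x) ≡ x ∷ xs
  rotate-∷ʳ xs x = cong₂ _∷_ (last-∷ʳ x xs) (init-∷ʳ x xs)

  rotate⁻¹-rotate : ∀ {n} (xs : Vec A (suc n)) → rotate⁻¹ (rotate xs) ≡ xs
  rotate⁻¹-rotate xs = sym (proj₂ (proj₂ (initLast xs)))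

  rotate-rotate⁻¹ : ∀ {n} (xs : Vec A (suc n)) → rotate (rotate⁻¹ xs) ≡ xs
  rotate-rotate⁻¹ (x ∷ xs) = rotate-∷ʳ xs x

  replicate-∷ʳ : ∀ n (x : A) → replicate n x ∷ʳ x ≡ replicate (suc n) x
  replicate-∷ʳ zero    x = refl
  replicate-∷ʳ (suc n) x = cong (x ∷_) (replicate-∷ʳ n x)

  rotate-replicate : ∀ n (x : A) → rotate (replicate (suc n) x) ≡ replicate (suc n) x
  rotate-replicate n x = trans (cong rotate (sym (replicate-∷ʳ n x))) (rotate-∷ʳ (replicate n x) x)

flipAt : ∀ {n} → ℕ → Vec Bool n → Vec Bool n
flipAt _       []       = []
flipAt zero    (b ∷ bs) = not b ∷ bs
flipAt (suc i) (b ∷ bs) = b ∷ flipAt i bs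

flipAt-involutive : ∀ {n} i (xs : Vec Bool n) → flipAt i (flipAt i xs) ≡ xs
flipAt-involutive i       []       = refl
flipAt-involutive zero    (b ∷ bs) = cong (_∷ bs) (not-involutive b)
flipAt-involutive (suc i) (b ∷ bs) = cong (b ∷_) (flipAt-involutive i bs)

flipAt-comm : ∀ {n} i j (xs : Vec Bool n) → flipAt i (flipAt j xs) ≡ flipAt j (flipAt i xs)
flipAt-comm i       j       []       = refl
flipAt-comm zero    zero    (b ∷ bs) = refl
flipAt-comm zero    (suc j) (b ∷ bs) = refl
flipAt-comm (suc i) zero    (b ∷ bs) = refl
flipAt-comm (suc i) (suc j) (b ∷ bs) = cong (b ∷_) (flipAt-comm i j bs)

rotate-flipAt : ∀ {n} i → i < n → (xs : Vec Bool (suc n)) →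
                rotate (flipAt i xs) ≡ flipAt (suc i) (rotate xs)
rotate-flipAt {suc n} zero    _       (b ∷ bs) = refl
rotate-flipAt {suc n} (suc i) (s≤s p) (b ∷ bs) = cong (λ v → head v ∷ b ∷ tail v) (rotate-flipAt i p bs)

rotate-flipAt-last : ∀ {n} (xs : Vec Bool (suc n)) → rotate (flipAt n xs) ≡ flipAt 0 (rotate xs)
rotate-flipAt-last {zero}  (b ∷ []) = refl
rotate-flipAt-last {suc n} (b ∷ bs) = cong (λ v → head v ∷ b ∷ tail v) (rotate-flipAt-last bs)

xorPrefix : ∀ {m n} → Vec Bool m → Vec Bool n → Vec Bool n
xorPrefix []       ys       = ys
xorPrefix (b ∷ bs) []       = []
xorPrefix (b ∷ bs) (c ∷ cs) = (b xor c) ∷ xorPrefix bs cs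

xorPrefix-∷ʳ : ∀ {m n} (bs : Vec Bool m) (cs : Vec Bool n) c → m ≤ n →
               xorPrefix bs (cs ∷ʳ c) ≡ xorPrefix bs cs ∷ʳ c
xorPrefix-∷ʳ []       cs       c _       = refl
xorPrefix-∷ʳ (b ∷ bs) (c′ ∷ cs) c (s≤s p) = cong ((b xor c′) ∷_) (xorPrefix-∷ʳ bs cs c p)

xorPrefix-replicate : ∀ {n} (bs : Vec Bool n) → xorPrefix bs (replicate n false) ≡ bs
xorPrefix-replicate []       = refl
xorPrefix-replicate (b ∷ bs) = cong₂ _∷_ (xor-identityʳ b) (xorPrefix-replicate bs)

allVecs : ∀ n → List (Vec Bool n)
allVecs zero    = [] ∷ []
allVecs (suc n) = map (true ∷_) (allVecs n) ++ map (false ∷_) (allVecs n)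

∈-allVecs : ∀ {n} (bs : Vec Bool n) → bs ∈ allVecs n
∈-allVecs []             = here refl
∈-allVecs (true ∷ bs)    = ∈-++⁺ˡ (∈-map⁺ (true ∷_) (∈-allVecs bs))
∈-allVecs {suc n} (false ∷ bs) = ∈-++⁺ʳ (map (true ∷_) (allVecs n)) (∈-map⁺ (false ∷_) (∈-allVecs bs))

dConj : ℕ → Word Gen
dConj n = conj wd (pow wa n)

module LN (M : ℕ) where

  State : Set
  State = Vec Bool (suc M)

  step : State → Lit Gen → State
  step x (pos a) = rotate x
  step x (neg a) = rotate⁻¹ x
  step x (pos d) = flipAt 0 x
  step x (neg d) = flipAt 0 x

  cocycle : State → Lit Gen → Word Bool
  cocycle x (pos a) = pos (last x) ∷ []
  cocycle x (neg a) = neg (head x) ∷ []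
  cocycle x (pos d) = []
  cocycle x (neg d) = []

  step-invLit : ∀ x l → step (step x l) (invLit l) ≡ x
  step-invLit x (pos a) = rotate⁻¹-rotate x
  step-invLit x (neg a) = rotate-rotate⁻¹ x
  step-invLit x (pos d) = flipAt-involutive 0 x
  step-invLit x (neg d) = flipAt-involutive 0 x

  cocycle-invLit : ∀ x l → cocycle (step x l) (invLit l) ≡ inv (cocycle x l)
  cocycle-invLit x        (pos a) = refl
  cocycle-invLit (b ∷ bs) (neg a) = cong (λ c → pos c ∷ []) (last-∷ʳ b bs)
  cocycle-invLit x        (pos d) = refl
  cocycle-invLit x        (neg d) = refl

  open CocycleAction step cocycle step-invLit cocycle-invLit public

  act-pow-a-flipAt : ∀ n j y → j + n ≤ M → act (flipAt j y) (pow wa n) ≡ flipAt (j + n) (act y (pow wa n))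
  act-pow-a-flipAt zero    j y _ = cong (λ k → flipAt k y) (sym (+-identityʳ j))
  act-pow-a-flipAt (suc n) j y h = begin
    act (rotate (flipAt j y)) (pow wa n)
      ≡⟨ cong (λ z → act z (pow wa n)) (rotate-flipAt j (m+n≤o⇒m≤o (suc j) h′) y) ⟩
    act (flipAt (suc j) (rotate y)) (pow wa n)    ≡⟨ act-pow-a-flipAt n (suc j) (rotate y) h′ ⟩
    flipAt (suc j + n) (act (rotate y) (pow wa n))
      ≡⟨ cong (λ k → flipAt k (act (rotate y) (pow wa n))) (+-suc j n) ⟨
    flipAt (j + suc n) (act y (pow wa (suc n)))    ∎
    where open ≡-Reasoning
          h′ = subst (_≤ M) (+-suc j n) h

  cocycleʷ-pow-a-flipAt : ∀ n j y → j + n ≤ M → cocycleʷ (flipAt j y) (pow wa n) ≡ cocycleʷ y (pow wa n)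
  cocycleʷ-pow-a-flipAt zero    j y _ = refl
  cocycleʷ-pow-a-flipAt (suc n) j y h =
    cong₂ (λ b w → pos b ∷ w) (cong head (rotate-flipAt j j<M y))
      (trans (cong (λ z → cocycleʷ z (pow wa n)) (rotate-flipAt j j<M y))
             (cocycleʷ-pow-a-flipAt n (suc j) (rotate y) h′))
    where h′ = subst (_≤ M) (+-suc j n) h
          j<M = m+n≤o⇒m≤o (suc j) h′

  act-dConj : ∀ {n} → n ≤ M → ∀ y → act y (dConj n) ≡ flipAt n y
  act-dConj {n} n≤M y = begin
    act y (inv (pow wa n) ++ wd ++ pow wa n)           ≡⟨ act-++ y (inv (pow wa n)) _ ⟩
    act (flipAt 0 y′) (pow wa n)                        ≡⟨ act-pow-a-flipAt n 0 y′ n≤M ⟩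
    flipAt n (act (act y (inv (pow wa n))) (pow wa n))  ≡⟨ cong (flipAt n) (act-inverseˡ y (pow wa n)) ⟩
    flipAt n y                                          ∎
    where open ≡-Reasoning
          y′ = act y (inv (pow wa n))

  cocycleTrivial-dConj : ∀ {n} → n ≤ M → CocycleTrivial (dConj n)
  cocycleTrivial-dConj {n} n≤M y = begin
    cocycleʷ y (inv (pow wa n) ++ wd ++ pow wa n)
      ≡⟨ cocycleʷ-++ y (inv (pow wa n)) _ ⟩
    cocycleʷ y (inv (pow wa n)) ++ cocycleʷ (flipAt 0 y′) (pow wa n)
      ≡⟨ cong₂ _++_ (cocycleʷ-inverseˡ y (pow wa n)) (cocycleʷ-pow-a-flipAt n 0 y′ n≤M) ⟩
    inv (cocycleʷ y′ (pow wa n)) ++ cocycleʷ y′ (pow wa n)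
      ≈⟨ F.++-inverseˡ (cocycleʷ y′ (pow wa n)) ⟩
    [] ∎
    where open F
          y′ = act y (inv (pow wa n))

  cocycleTrivial-d : CocycleTrivial wd
  cocycleTrivial-d _ = ≈refl

  act-inv-flipAt : ∀ {w} i → (∀ y → act y w ≡ flipAt i y) → ∀ y → act y (inv w) ≡ flipAt i y
  act-inv-flipAt {w} i act-w y = begin
    act y (inv w)                          ≡⟨ flipAt-involutive i _ ⟨
    flipAt i (flipAt i (act y (inv w)))    ≡⟨ cong (flipAt i) (act-w (act y (inv w))) ⟨
    flipAt i (act (act y (inv w)) w)       ≡⟨ cong (flipAt i) (act-inverseˡ y w) ⟩
    flipAt i y                             ∎
    where open ≡-Reasoning

  fixesRelators : FixesRelators (LRel (suc M))
  fixesRelators (inj₁ refl) = flipAt-involutive 0 , λ _ → ≈refl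
  fixesRelators (inj₂ (suc k , _ , s≤s k<M , refl)) = act-comm , trivial
    where
    v = dConj (suc k)
    act-v : ∀ y → act y v ≡ flipAt (suc k) y
    act-v = act-dConj k<M
    act-comm : ∀ x → act x (comm wd v) ≡ x
    act-comm x = begin
      act (flipAt 0 x) (inv v ++ wd ++ v)
        ≡⟨ act-++ (flipAt 0 x) (inv v) (wd ++ v) ⟩
      act (flipAt 0 (act (flipAt 0 x) (inv v))) v
        ≡⟨ act-v _ ⟩
      flipAt (suc k) (flipAt 0 (act (flipAt 0 x) (inv v)))
        ≡⟨ cong (λ z → flipAt (suc k) (flipAt 0 z)) (act-inv-flipAt {v} (suc k) act-v (flipAt 0 x)) ⟩
      flipAt (suc k) (flipAt 0 (flipAt (suc k) (flipAt 0 x)))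
        ≡⟨ cong (λ z → flipAt (suc k) (flipAt 0 z)) (flipAt-comm (suc k) 0 x) ⟩
      flipAt (suc k) (flipAt 0 (flipAt 0 (flipAt (suc k) x)))
        ≡⟨ cong (flipAt (suc k)) (flipAt-involutive 0 _) ⟩
      flipAt (suc k) (flipAt (suc k) x)
        ≡⟨ flipAt-involutive (suc k) x ⟩
      x ∎
      where open ≡-Reasoning
    trivial-v : CocycleTrivial v
    trivial-v = cocycleTrivial-dConj k<M
    trivial : CocycleTrivial (comm wd v)
    trivial = cocycleTrivial-++ (inv wd) (inv v ++ wd ++ v) (cocycleTrivial-inv wd cocycleTrivial-d)
                (cocycleTrivial-++ (inv v) (wd ++ v) (cocycleTrivial-inv v trivial-v)
                  (cocycleTrivial-++ wd v cocycleTrivial-d trivial-v))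

  dPow : Bool → Word Gen
  dPow false = []
  dPow true  = wd

  transversal : ∀ {n} → Vec Bool n → Word Gen
  transversal []       = []
  transversal (b ∷ bs) = conj (transversal bs) wa ++ dPow b

  ι : Bool → Word Gen
  ι false = wa
  ι true  = dConj M ++ wa ++ wd

  act-dPow : ∀ b c (cs : Vec Bool M) → act (c ∷ cs) (dPow b) ≡ (b xor c) ∷ cs
  act-dPow false c cs = refl
  act-dPow true  c cs = refl

  act-transversal : ∀ {L} (bs : Vec Bool L) → L ≤ suc M → ∀ y → act y (transversal bs) ≡ xorPrefix bs y
  act-transversal []       _       y        = refl
  act-transversal (b ∷ bs) (s≤s h) (c ∷ cs) = begin
    act (cs ∷ʳ c) ((transversal bs ++ wa) ++ dPow b)
      ≡⟨ act-++ (cs ∷ʳ c) (transversal bs ++ wa) (dPow b) ⟩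
    act (act (cs ∷ʳ c) (transversal bs ++ wa)) (dPow b)
      ≡⟨ cong (λ z → act z (dPow b)) (act-++ (cs ∷ʳ c) (transversal bs) wa) ⟩
    act (rotate (act (cs ∷ʳ c) (transversal bs))) (dPow b)
      ≡⟨ cong (λ z → act (rotate z) (dPow b)) (act-transversal bs (m≤n⇒m≤1+n h) (cs ∷ʳ c)) ⟩
    act (rotate (xorPrefix bs (cs ∷ʳ c))) (dPow b)
      ≡⟨ cong (λ z → act (rotate z) (dPow b)) (xorPrefix-∷ʳ bs cs c h) ⟩
    act (rotate (xorPrefix bs cs ∷ʳ c)) (dPow b)
      ≡⟨ cong (λ z → act z (dPow b)) (rotate-∷ʳ (xorPrefix bs cs) c) ⟩
    act (c ∷ xorPrefix bs cs) (dPow b)                     ≡⟨ act-dPow b c (xorPrefix bs cs) ⟩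
    (b xor c) ∷ xorPrefix bs cs                            ∎
    where open ≡-Reasoning

  zeros : State
  zeros = replicate (suc M) false

  act-zeros-transversal : ∀ x → act zeros (transversal x) ≡ x
  act-zeros-transversal x = trans (act-transversal x ≤-refl zeros) (xorPrefix-replicate x)

  ι-fixes : ∀ b → act zeros (ι b) ≡ zeros
  ι-fixes false = rotate-replicate M false
  ι-fixes true  = begin
    act zeros (dConj M ++ wa ++ wd)                  ≡⟨ act-++ zeros (dConj M) (wa ++ wd) ⟩
    flipAt 0 (rotate (act zeros (dConj M)))
      ≡⟨ cong (λ z → flipAt 0 (rotate z)) (act-dConj ≤-refl zeros) ⟩
    flipAt 0 (rotate (flipAt M zeros))               ≡⟨ cong (flipAt 0) (rotate-flipAt-last zeros) ⟩
    flipAt 0 (flipAt 0 (rotate zeros))               ≡⟨ flipAt-involutive 0 (rotate zeros) ⟩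
    rotate zeros                                     ≡⟨ rotate-replicate M false ⟩
    zeros                                            ∎
    where open ≡-Reasoning

  ι-cocycle : ∀ b → cocycleʷ zeros (ι b) F.≈ pos b ∷ []
  ι-cocycle false = F.reflexive (cong (λ z → pos (head z) ∷ []) (rotate-replicate M false))
  ι-cocycle true  =
    ≈trans (F.reflexive (cocycleʷ-++ zeros (dConj M) (wa ++ wd)))
      (≈trans (F.++-congʳ _ (cocycleTrivial-dConj ≤-refl zeros))
              (F.reflexive (cong (λ b → pos b ∷ []) last≡true)))
    where
    last≡true : last (act zeros (dConj M)) ≡ true
    last≡true = begin
      last (act zeros (dConj M))        ≡⟨ cong last (act-dConj ≤-refl zeros) ⟩
      last (flipAt M zeros)             ≡⟨ cong head (rotate-flipAt-last zeros) ⟩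
      not (last zeros)                  ≡⟨ cong (λ z → not (head z)) (rotate-replicate M false) ⟩
      true                              ∎
      where open ≡-Reasoning

  open Presentation (LRel (suc M))

  d²≈[] : wd ++ wd ≈ []
  d²≈[] = relator≈[] (inj₁ refl)

  d-commutes-dConj : ∀ {k} → 1 ≤ k → k ≤ M → Commute wd (dConj k)
  d-commutes-dConj {k} 1≤k k≤M =
    comm≈[]⇒commute wd (dConj k) (relator≈[] (inj₂ (k , 1≤k , s≤s k≤M , refl)))

  dPow-d : ∀ b → dPow b ++ wd ≈ dPow (not b)
  dPow-d false = ≈refl
  dPow-d true  = d²≈[]

  transversal-last : ∀ {L} (x : Vec Bool (suc L)) →
                     transversal x ≈ conj (dPow (last x)) (pow wa L) ++ transversal (init x)
  transversal-last {zero}  (b ∷ []) = begin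
    neg a ∷ pos a ∷ dPow b   ≈⟨ cancel [] (neg a) (dPow b) ⟩
    dPow b                   ≡⟨ trans (++-identityʳ (dPow b ++ [])) (++-identityʳ (dPow b)) ⟨
    (dPow b ++ []) ++ []     ∎
  transversal-last {suc L} (b ∷ xs) = begin
    conj (transversal xs) wa ++ dPow b
      ≈⟨ ++-congʳ (dPow b) (conj-cong wa (transversal-last xs)) ⟩
    conj (D ++ T) wa ++ dPow b                       ≈⟨ ++-congʳ (dPow b) (conj-++ wa D T) ⟩
    (conj D wa ++ conj T wa) ++ dPow b               ≡⟨ cong (λ z → (z ++ conj T wa) ++ dPow b) conj-D ⟩
    (conj (dPow (last xs)) (pow wa (suc L)) ++ conj T wa) ++ dPow b
                                                     ≡⟨ ++-assoc (conj (dPow (last xs)) (pow wa (suc L))) _ _ ⟩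
    conj (dPow (last xs)) (pow wa (suc L)) ++ transversal (b ∷ init xs) ∎
    where
    D = conj (dPow (last xs)) (pow wa L)
    T = transversal (init xs)
    conj-D : conj D wa ≡ conj (dPow (last xs)) (pow wa (suc L))
    conj-D = trans (conj-conj (dPow (last xs)) (pow wa L) wa)
                   (cong (conj (dPow (last xs))) (sym (pow-sucʳ wa L)))

  d-commutes-conj-transversal : ∀ {L} (v : Vec Bool L) k → 1 ≤ k → k + L ≤ suc M →
                                Commute wd (conj (transversal v) (pow wa k))
  d-commutes-conj-transversal []       k _   _ = commute-resp (≈sym (conj-[] (pow wa k))) (commute-[] wd)
  d-commutes-conj-transversal {suc L} (b ∷ bs) k 1≤k h =
    commute-resp (≈sym (conj-++ (pow wa k) (conj (transversal bs) wa) (dPow b)))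
      (commute-++ {wd} {conj (conj (transversal bs) wa) (pow wa k)} {conj (dPow b) (pow wa k)}
        commutes-bs (commutes-dPow b))
    where
    h′ : suc k + L ≤ suc M
    h′ = subst (_≤ suc M) (+-suc k L) h
    commutes-bs : Commute wd (conj (conj (transversal bs) wa) (pow wa k))
    commutes-bs = subst (Commute wd) (sym (conj-conj (transversal bs) wa (pow wa k)))
                        (d-commutes-conj-transversal bs (suc k) (s≤s z≤n) h′)
    commutes-dPow : ∀ b → Commute wd (conj (dPow b) (pow wa k))
    commutes-dPow false = commute-resp (≈sym (conj-[] (pow wa k))) (commute-[] wd)
    commutes-dPow true  = d-commutes-dConj 1≤k (m+n≤o⇒m≤o k (≤-pred h′))

  transversal-replicate : ∀ n → transversal (replicate n false) ≈ []
  transversal-replicate zero    = ≈refl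
  transversal-replicate (suc n) =
    ≈trans (reflexive (++-identityʳ _)) (≈trans (conj-cong wa (transversal-replicate n)) (conj-[] wa))

  transversal-step-a : (x : State) → transversal x ++ wa ≈ (ι (last x) ++ []) ++ transversal (rotate x)
  transversal-step-a x = begin
    transversal x ++ wa                      ≈⟨ ++-congʳ wa (transversal-last x) ⟩
    (D ++ T) ++ wa                           ≡⟨ ++-assoc D T wa ⟩
    D ++ T ++ wa                             ≈⟨ ++-congˡ D (++-conj wa T) ⟨
    D ++ wa ++ conj T wa                     ≈⟨ last-bit-step (last x) (conj T wa) commutes ⟩
    (ι (last x) ++ []) ++ conj T wa ++ dPow (last x) ∎
    where
    D = conj (dPow (last x)) (pow wa M)
    T = transversal (init x)
    commutes : Commute wd (conj T wa)
    commutes = subst (λ p → Commute wd (conj T p)) (++-identityʳ wa)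
                     (d-commutes-conj-transversal (init x) 1 (s≤s z≤n) ≤-refl)
    last-bit-step : ∀ b Q → Commute wd Q → conj (dPow b) (pow wa M) ++ wa ++ Q ≈ (ι b ++ []) ++ Q ++ dPow b
    last-bit-step false Q _  = begin
      conj [] (pow wa M) ++ wa ++ Q    ≈⟨ ++-congʳ (wa ++ Q) (conj-[] (pow wa M)) ⟩
      wa ++ Q                          ≡⟨ cong (wa ++_) (++-identityʳ Q) ⟨
      (wa ++ []) ++ Q ++ []            ∎
    last-bit-step true  Q dQ = begin
      dConj M ++ wa ++ Q                   ≈⟨ ++-congˡ (dConj M) (++-congˡ wa d²-cancel) ⟨
      dConj M ++ wa ++ wd ++ wd ++ Q       ≈⟨ ++-congˡ (dConj M) (++-congˡ (wa ++ wd) dQ) ⟩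
      dConj M ++ wa ++ wd ++ Q ++ wd       ≡⟨ ++-assoc (dConj M) (wa ++ wd) (Q ++ wd) ⟨
      (dConj M ++ wa ++ wd) ++ Q ++ wd     ≡⟨ cong (_++ Q ++ wd) (++-identityʳ (dConj M ++ wa ++ wd)) ⟨
      (ι true ++ []) ++ Q ++ wd            ∎
      where
      d²-cancel : wd ++ wd ++ Q ≈ Q
      d²-cancel = ≈trans (reflexive (sym (++-assoc wd wd Q))) (++-congʳ Q d²≈[])

  transversal-step-d : (x : State) → transversal x ++ wd ≈ transversal (flipAt 0 x)
  transversal-step-d (b ∷ bs) =
    ≈trans (reflexive (++-assoc (conj (transversal bs) wa) (dPow b) wd))
           (++-congˡ (conj (transversal bs) wa) (dPow-d b))

  transversal-step : ∀ x g →
                     transversal x ++ pos g ∷ [] ≈ eval ι (cocycle x (pos g)) ++ transversal (step x (pos g))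
  transversal-step x a = transversal-step-a x
  transversal-step x d = transversal-step-d x

lemma4p2 : (N : ℕ) → 1 ≤ N → VirtuallyFree (LRel N)
lemma4p2 (suc M) _ =
  Stabiliser zeros ,
  stabiliser-isSubgroup fixesRelators zeros ,
  -- FiniteIndex does not mention the relators, so they cannot be inferred here.
  stabiliser-finiteIndex {LRel (suc M)} zeros (allVecs (suc M)) ∈-allVecs
    transversal act-zeros-transversal ,
  stabiliser-free fixesRelators zeros ι ι-fixes ι-cocycle
    transversal (transversal-replicate (suc M)) transversal-step
  where open LN M
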